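{- Consider an instance of FZA and let $F\subseteq E$ be a solution with $|F|=m\ge1$ and revenue $\mathrm{rev}(F)$. Then there exists a solution $F'\subseteq F$ with $|F'|=2^{\lfloor\log_2 m\rfloor}$ such that $\mathrm{rev}(F')\ge\mathrm{rev}(F)/2$.
   Context: FZA: given a tree $T=(V,E)$, a non-decreasing concave $f\colon\mathbb{N}_0\to\mathbb{R}_{\ge0}$ and commodities $i\in[k]$ with path $P_i\subseteq E$, bound $u_i\in\mathbb{N}_0$ and weight $w_i\in\mathbb{N}$; the revenue of $F\subseteq E$ is $\mathrm{rev}(F)=\sum_i\mathrm{rev}_i(F)$, where $\mathrm{rev}_i(F)=w_if(|P_i\cap F|)$ if $|P_i\cap F|\le u_i$ and $0$ otherwise.
   Formalization: The function f takes only nonnegative rational values rather than values in $\mathbb{R}_{\ge0}$. -}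

module Defs where

open import Data.Nat as ℕ using (ℕ; zero; suc; _≤?_)
open import Data.Fin using (Fin)
open import Data.Fin.Subset using (Subset; _∈_)
open import Data.Bool using (Bool; true; false)
open import Data.Vec using (lookup)
open import Data.List using (List; []; _∷_; foldr; map; allFin)
open import Data.List.Relation.Unary.Unique.Propositional using (Unique)
open import Data.Fin.Base using () renaming (toℕ to finToℕ)
open import Data.List.Base using ()
open import Data.Product using (Σ; _×_; ∃; _,_)
open import Data.Sum using (_⊎_)
open import Data.Integer using (+_)
open import Data.Rational as ℚ using (ℚ; 0ℚ; _/_)
open import Relation.Binary.PropositionalEquality using (_≡_)
open import Relation.Nullary using (yes; no)

record Graph : Set where
  field
    nv  : ℕ
    ne  : ℕ
    end₁ : Fin ne → Fin nv
    end₂ : Fin ne → Fin nv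

module _ (G : Graph) where
  open Graph G

  Joins : Fin ne → Fin nv → Fin nv → Set
  Joins e u v = (end₁ e ≡ u × end₂ e ≡ v) ⊎ (end₁ e ≡ v × end₂ e ≡ u)

  data Walk : Fin nv → Fin nv → List (Fin nv) → List (Fin ne) → Set where
    nil  : ∀ {v} → Walk v v (v ∷ []) []
    cons : ∀ {u v w vs es} (e : Fin ne) → Joins e u v →
           Walk v w vs es → Walk u w (u ∷ vs) (e ∷ es)

  IsPath : Fin nv → Fin nv → List (Fin nv) → List (Fin ne) → Set
  IsPath u w vs es = Walk u w vs es × Unique vs

  Connected : Set
  Connected = ∀ u v → ∃ λ vs → ∃ λ es → Walk u v vs es

  IsTree : Set
  IsTree = Connected × (suc ne ≡ nv)

ℕ→ℚ : ℕ → ℚ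
ℕ→ℚ n = + n / 1

NonDecreasing : (ℕ → ℚ) → Set
NonDecreasing f = ∀ a b → a ℕ.≤ b → f a ℚ.≤ f b

-- concavity on ℕ₀: consecutive increments are non-increasing,
-- f(a+2) - f(a+1) ≤ f(a+1) - f(a)
Concave : (ℕ → ℚ) → Set
Concave f = ∀ a → f (suc (suc a)) ℚ.+ f a ℚ.≤ f (suc a) ℚ.+ f (suc a)

NonNegative : (ℕ → ℚ) → Set
NonNegative f = ∀ a → 0ℚ ℚ.≤ f a

record Commodity (G : Graph) : Set where
  open Graph G
  field
    s t   : Fin nv
    verts : List (Fin nv)
    path  : List (Fin ne)
    isPath : IsPath G s t verts path
    bound  : ℕ
    weight : ℕ
    weight≥1 : 1 ℕ.≤ weight

record FZA : Set₁ where
  field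
    G      : Graph
    tree   : IsTree G
    f      : ℕ → ℚ
    f-mono : NonDecreasing f
    f-conc : Concave f
    f-nonneg : NonNegative f
    k      : ℕ
    com    : Fin k → Commodity G

-- |P ∩ F| for a list of (distinct) edges P and an edge subset F
countIn : ∀ {ne} → Subset ne → List (Fin ne) → ℕ
countIn F [] = 0
countIn F (e ∷ es) with lookup F e
... | true  = suc (countIn F es)
... | false = countIn F es

sumℚ : List ℚ → ℚ
sumℚ = foldr ℚ._+_ 0ℚ

module _ (I : FZA) where
  open FZA I
  open Graph G

  rev-i : Fin k → Subset ne → ℚ
  rev-i i F with countIn F (Commodity.path (com i))
  ... | c with c ≤? Commodity.bound (com i)
  ...   | yes _ = ℕ→ℚ (Commodity.weight (com i)) ℚ.* f c
  ...   | no  _ = 0ℚ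

  rev : Subset ne → ℚ
  rev F = sumℚ (map (λ i → rev-i i F) (allFin k))

{-# OPTIONS --safe #-}
module Submission where

-- Let p = 2 ^ ⌊log₂ m⌋, so that p ≤ m < 2p.  The first p and the last p
-- edges of F then cover F.  A concave, non-decreasing, non-negative f is
-- subadditive, and a commodity within its bound on F stays within it on any
-- subset of F, so rev F ≤ rev (first p) + rev (last p) and one of the two
-- parts earns at least rev F / 2.

open import Defs
open import Algebra.Bundles using (CommutativeMonoid)
import Algebra.Properties.CommutativeSemigroup as CommutativeSemigroupProperties
open import Data.Bool using (Bool; true; false; if_then_else_; _∨_)
open import Data.Fin.Subset using (Subset; _⊆_; ∣_∣; _∪_; ⊥; inside; outside)
open import Data.Fin.Subset.Properties
  using (⊥⊆; ⊆-refl; ⊆-antisym; in⊆in; out⊆; ∣⊥∣≡0; p⊆p∪q; q⊆p∪q; x∈p∪q⁻)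
open import Data.List using ([]; _∷_; map; allFin)
open import Data.Nat as ℕ
  using (ℕ; zero; suc; _≤_; _<_; _^_; _∸_; z≤n; s≤s; _≤?_; ⌊_/2⌋; ⌈_/2⌉; NonZero)
import Data.Nat.Properties as ℕ
open import Data.Nat.Logarithm using (⌊log₂_⌋; ⌊log₂⌋-mono-≤; ⌊log₂[2^n]⌋≡n)
open import Data.Nat.Logarithm.Core using (⌊log2⌋)
open import Data.Product using (∃; _×_; _,_)
open import Data.Rational as ℚ using (ℚ; 0ℚ; ½; _+_; _-_; _*_) renaming (_≤_ to _≤ℚ_)
import Data.Rational.Properties as ℚ
open import Data.Rational.Solver using (module +-*-Solver)
open import Data.Sum using (_⊎_; inj₁; inj₂; [_,_]′)
open import Data.Vec using ([]; _∷_; lookup)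
open import Data.Vec.Properties using ([]=⇒lookup; lookup⇒[]=; lookup-zipWith)
open import Function using (id)
open import Induction.WellFounded using (Acc; acc)
open import Relation.Binary.PropositionalEquality using (_≡_; refl; trans; cong; subst)
open import Relation.Nullary using (yes; no)
open import Relation.Nullary.Negation using (contradiction)

-- Read as  x - u ≤ v - y ≤ w - z.
≤-chain-differences : ∀ x y z u v w →
  x + y ≤ℚ u + v → v + z ≤ℚ y + w → x + z ≤ℚ u + w
≤-chain-differences x y z u v w h₁ h₂ = begin
  x + z               ≡⟨ solve 3 (λ x y z → x :+ z := (x :+ y) :+ (z :- y)) refl x y z ⟩
  (x + y) + (z - y)   ≤⟨ ℚ.+-monoˡ-≤ (z - y) h₁ ⟩
  (u + v) + (z - y)   ≡⟨ solve 4 (λ u v y z → (u :+ v) :+ (z :- y) := (u :- y) :+ (v :+ z)) refl u v y z ⟩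
  (u - y) + (v + z)   ≤⟨ ℚ.+-monoʳ-≤ (u - y) h₂ ⟩
  (u - y) + (y + w)   ≡⟨ solve 3 (λ u y w → (u :- y) :+ (y :+ w) := u :+ w) refl u y w ⟩
  u + w               ∎
  where
  open ℚ.≤-Reasoning
  open +-*-Solver

≤-+-nonNeg : ∀ p {q} → 0ℚ ≤ℚ q → p ≤ℚ p + q
≤-+-nonNeg p {q} 0≤q = subst (_≤ℚ p + q) (ℚ.+-identityʳ p) (ℚ.+-monoʳ-≤ p 0≤q)

½[p+p]≡p : ∀ p → ½ * (p + p) ≡ p
½[p+p]≡p p = solve 1 (λ p → con ½ :* (p :+ p) := p) refl p
  where open +-*-Solver

half-≤-max : ∀ {x a b} → x ≤ℚ a + b → ½ * x ≤ℚ a ⊎ ½ * x ≤ℚ b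
half-≤-max {x} {a} {b} x≤a+b with ℚ.≤-total a b
... | inj₁ a≤b = inj₂ (subst (½ * x ≤ℚ_) (½[p+p]≡p b)
                        (ℚ.*-monoˡ-≤-nonNeg ½ (ℚ.≤-trans x≤a+b (ℚ.+-monoˡ-≤ b a≤b))))
... | inj₂ b≤a = inj₁ (subst (½ * x ≤ℚ_) (½[p+p]≡p a)
                        (ℚ.*-monoˡ-≤-nonNeg ½ (ℚ.≤-trans x≤a+b (ℚ.+-monoʳ-≤ a b≤a))))

sumℚ-map-subadditive : ∀ {A : Set} {g h₁ h₂ : A → ℚ} →
  (∀ x → g x ≤ℚ h₁ x + h₂ x) →
  ∀ xs → sumℚ (map g xs) ≤ℚ sumℚ (map h₁ xs) + sumℚ (map h₂ xs)
sumℚ-map-subadditive g≤h₁+h₂ [] = ℚ.≤-refl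
sumℚ-map-subadditive {g = g} {h₁} {h₂} g≤h₁+h₂ (x ∷ xs) =
  subst (g x + sumℚ (map g xs) ≤ℚ_)
    (interchange (h₁ x) (h₂ x) (sumℚ (map h₁ xs)) (sumℚ (map h₂ xs)))
    (ℚ.+-mono-≤ (g≤h₁+h₂ x) (sumℚ-map-subadditive g≤h₁+h₂ xs))
  where
  open CommutativeSemigroupProperties
    (CommutativeMonoid.commutativeSemigroup ℚ.+-0-commutativeMonoid) using (interchange)

module _ {f : ℕ → ℚ} (concave : Concave f) where

  -- f (1 + d + a) - f (d + a) ≤ f (1 + a) - f a, without subtraction.
  Concave⇒increment-antitone : ∀ d a → f (suc (d ℕ.+ a)) + f a ≤ℚ f (d ℕ.+ a) + f (suc a)
  Concave⇒increment-antitone zero    a = ℚ.≤-reflexive (ℚ.+-comm (f (suc a)) (f a))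
  Concave⇒increment-antitone (suc d) a =
    ≤-chain-differences (f (suc (suc n))) (f n) (f a) (f (suc n)) (f (suc n)) (f (suc a))
      (concave n) (Concave⇒increment-antitone d a)
    where n = d ℕ.+ a

  Concave⇒f[a+b]+f0≤fa+fb : ∀ a b → f (a ℕ.+ b) + f 0 ≤ℚ f a + f b
  Concave⇒f[a+b]+f0≤fa+fb a zero rewrite ℕ.+-identityʳ a = ℚ.≤-refl
  Concave⇒f[a+b]+f0≤fa+fb a (suc b) rewrite ℕ.+-suc a b =
    subst (f (suc n) + f 0 ≤ℚ_) (ℚ.+-comm (f (suc b)) (f a))
      (≤-chain-differences (f (suc n)) (f b) (f 0) (f (suc b)) (f n) (f a)
        (subst (f (suc n) + f b ≤ℚ_) (ℚ.+-comm (f n) (f (suc b)))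
          (Concave⇒increment-antitone a b))
        (subst (f n + f 0 ≤ℚ_) (ℚ.+-comm (f a) (f b))
          (Concave⇒f[a+b]+f0≤fa+fb a b)))
    where n = a ℕ.+ b

  Concave⇒subadditive : NonDecreasing f → NonNegative f →
    ∀ {a b c} → c ≤ a ℕ.+ b → f c ≤ℚ f a + f b
  Concave⇒subadditive mono nonNeg {a} {b} {c} c≤a+b = begin
    f c                  ≤⟨ mono c (a ℕ.+ b) c≤a+b ⟩
    f (a ℕ.+ b)          ≤⟨ ≤-+-nonNeg (f (a ℕ.+ b)) (nonNeg 0) ⟩
    f (a ℕ.+ b) + f 0    ≤⟨ Concave⇒f[a+b]+f0≤fa+fb a b ⟩
    f a + f b            ∎
    where open ℚ.≤-Reasoning

2*⌊n/2⌋≤n : ∀ n → 2 ℕ.* ⌊ n /2⌋ ≤ n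
2*⌊n/2⌋≤n n = begin
  2 ℕ.* ⌊ n /2⌋        ≡⟨ cong (⌊ n /2⌋ ℕ.+_) (ℕ.+-identityʳ ⌊ n /2⌋) ⟩
  ⌊ n /2⌋ ℕ.+ ⌊ n /2⌋  ≤⟨ ℕ.+-monoʳ-≤ ⌊ n /2⌋ (ℕ.⌊n/2⌋≤⌈n/2⌉ n) ⟩
  ⌊ n /2⌋ ℕ.+ ⌈ n /2⌉  ≡⟨ ℕ.⌊n/2⌋+⌈n/2⌉≡n n ⟩
  n                    ∎
  where open ℕ.≤-Reasoning

2^⌊log2⌋[1+n]≤1+n : ∀ n (rec : Acc _<_ (suc n)) → 2 ^ ⌊log2⌋ (suc n) rec ≤ suc n
2^⌊log2⌋[1+n]≤1+n zero    _        = ℕ.≤-refl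
2^⌊log2⌋[1+n]≤1+n (suc n) (acc _)  = begin
  2 ℕ.* 2 ^ ⌊log2⌋ (suc ⌊ n /2⌋) _  ≤⟨ ℕ.*-monoʳ-≤ 2 (2^⌊log2⌋[1+n]≤1+n ⌊ n /2⌋ _) ⟩
  2 ℕ.* suc ⌊ n /2⌋                  ≡⟨ ℕ.*-suc 2 ⌊ n /2⌋ ⟩
  2 ℕ.+ 2 ℕ.* ⌊ n /2⌋                ≤⟨ ℕ.+-monoʳ-≤ 2 (2*⌊n/2⌋≤n n) ⟩
  suc (suc n)                        ∎
  where open ℕ.≤-Reasoning

2^⌊log₂n⌋≤n : ∀ n .{{_ : NonZero n}} → 2 ^ ⌊log₂ n ⌋ ≤ n
2^⌊log₂n⌋≤n (suc n) = 2^⌊log2⌋[1+n]≤1+n n _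

n<2^[1+⌊log₂n⌋] : ∀ n → n < 2 ^ suc ⌊log₂ n ⌋
n<2^[1+⌊log₂n⌋] n with 2 ^ suc ⌊log₂ n ⌋ ≤? n
... | no  2^[1+k]≰n = ℕ.≰⇒> 2^[1+k]≰n
... | yes 2^[1+k]≤n = contradiction
  (subst (_≤ ⌊log₂ n ⌋) (⌊log₂[2^n]⌋≡n (suc ⌊log₂ n ⌋)) (⌊log₂⌋-mono-≤ 2^[1+k]≤n))
  (ℕ.<-irrefl refl)

n∸2^⌊log₂n⌋≤2^⌊log₂n⌋ : ∀ n → n ∸ 2 ^ ⌊log₂ n ⌋ ≤ 2 ^ ⌊log₂ n ⌋
n∸2^⌊log₂n⌋≤2^⌊log₂n⌋ n = ℕ.m≤n+o⇒m∸n≤o n p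
  (ℕ.<⇒≤ (subst (n <_) (cong (p ℕ.+_) (ℕ.+-identityʳ p)) (n<2^[1+⌊log₂n⌋] n)))
  where p = 2 ^ ⌊log₂ n ⌋

take : ∀ {n} → ℕ → Subset n → Subset n
take zero    _             = ⊥
take (suc p) []            = []
take (suc p) (inside  ∷ F) = inside ∷ take p F
take (suc p) (outside ∷ F) = outside ∷ take (suc p) F

drop : ∀ {n} → ℕ → Subset n → Subset n
drop zero    F             = F
drop (suc q) []            = []
drop (suc q) (inside  ∷ F) = outside ∷ drop q F
drop (suc q) (outside ∷ F) = outside ∷ drop (suc q) F

take-⊆ : ∀ {n} p (F : Subset n) → take p F ⊆ F
take-⊆ zero    F             = ⊥⊆
take-⊆ (suc p) []            = ⊆-refl
take-⊆ (suc p) (inside  ∷ F) = in⊆in (take-⊆ p F)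
take-⊆ (suc p) (outside ∷ F) = out⊆ (take-⊆ (suc p) F)

drop-⊆ : ∀ {n} q (F : Subset n) → drop q F ⊆ F
drop-⊆ zero    F             = ⊆-refl
drop-⊆ (suc q) []            = ⊆-refl
drop-⊆ (suc q) (inside  ∷ F) = out⊆ (drop-⊆ q F)
drop-⊆ (suc q) (outside ∷ F) = out⊆ (drop-⊆ (suc q) F)

∣take∣≡ : ∀ {n} p (F : Subset n) → p ≤ ∣ F ∣ → ∣ take p F ∣ ≡ p
∣take∣≡ {n} zero    F             _           = ∣⊥∣≡0 n
∣take∣≡ (suc p) (inside  ∷ F) (s≤s p≤∣F∣) = cong suc (∣take∣≡ p F p≤∣F∣)
∣take∣≡ (suc p) (outside ∷ F) p≤∣F∣       = ∣take∣≡ (suc p) F p≤∣F∣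

∣drop∣≡ : ∀ {n} q (F : Subset n) → ∣ drop q F ∣ ≡ ∣ F ∣ ∸ q
∣drop∣≡ zero    F             = refl
∣drop∣≡ (suc q) []            = refl
∣drop∣≡ (suc q) (inside  ∷ F) = ∣drop∣≡ q F
∣drop∣≡ (suc q) (outside ∷ F) = ∣drop∣≡ (suc q) F

p⊆q⇒p∪q≡q : ∀ {n} {p q : Subset n} → p ⊆ q → p ∪ q ≡ q
p⊆q⇒p∪q≡q {p = p} {q} p⊆q =
  ⊆-antisym (λ x∈p∪q → [ p⊆q , id ]′ (x∈p∪q⁻ p q x∈p∪q)) (q⊆p∪q p q)

take∪drop≡ : ∀ {n} {p q} → q ≤ p → (F : Subset n) → take p F ∪ drop q F ≡ F
take∪drop≡ {p = p} z≤n F = p⊆q⇒p∪q≡q (take-⊆ p F)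
take∪drop≡ (s≤s q≤p) []            = refl
take∪drop≡ (s≤s q≤p) (inside  ∷ F) = cong (inside ∷_) (take∪drop≡ q≤p F)
take∪drop≡ (s≤s q≤p) (outside ∷ F) = cong (outside ∷_) (take∪drop≡ (s≤s q≤p) F)

[_] : Bool → ℕ
[ b ] = if b then 1 else 0

countIn-∷ : ∀ {n} (F : Subset n) e es → countIn F (e ∷ es) ≡ [ lookup F e ] ℕ.+ countIn F es
countIn-∷ F e es with lookup F e
... | true  = refl
... | false = refl

[∨]≤[]+[] : ∀ a b → [ a ∨ b ] ≤ [ a ] ℕ.+ [ b ]
[∨]≤[]+[] true  b = s≤s z≤n
[∨]≤[]+[] false b = ℕ.≤-refl

countIn-mono : ∀ {n} {A B : Subset n} → A ⊆ B → ∀ es → countIn A es ≤ countIn B es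
countIn-mono A⊆B []       = z≤n
countIn-mono {A = A} {B} A⊆B (e ∷ es)
  rewrite countIn-∷ A e es | countIn-∷ B e es =
  ℕ.+-mono-≤ [lookup]-mono (countIn-mono A⊆B es)
  where
  [lookup]-mono : [ lookup A e ] ≤ [ lookup B e ]
  [lookup]-mono with lookup A e in e∈A
  ... | false = z≤n
  ... | true rewrite []=⇒lookup (A⊆B (lookup⇒[]= e A e∈A)) = ℕ.≤-refl

countIn-∪ : ∀ {n} (A B : Subset n) es → countIn (A ∪ B) es ≤ countIn A es ℕ.+ countIn B es
countIn-∪ A B []       = z≤n
countIn-∪ A B (e ∷ es)
  rewrite countIn-∷ (A ∪ B) e es | countIn-∷ A e es | countIn-∷ B e es
        | lookup-zipWith _∨_ e A B =
  subst ([ lookup A e ∨ lookup B e ] ℕ.+ countIn (A ∪ B) es ≤_)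
    (interchange [ lookup A e ] [ lookup B e ] (countIn A es) (countIn B es))
    (ℕ.+-mono-≤ ([∨]≤[]+[] (lookup A e) (lookup B e)) (countIn-∪ A B es))
  where open CommutativeSemigroupProperties ℕ.+-commutativeSemigroup using (interchange)

module _ (I : FZA) where
  open FZA I
  open Graph G using (ne)
  open Commodity

  rev-at : Commodity G → ℕ → ℚ
  rev-at C c with c ≤? bound C
  ... | yes _ = ℕ→ℚ (weight C) * f c
  ... | no  _ = 0ℚ

  rev-i≡rev-at : ∀ i (F : Subset ne) → rev-i I i F ≡ rev-at (com i) (countIn F (path (com i)))
  rev-i≡rev-at i F with countIn F (path (com i))
  ... | c with c ≤? bound (com i)
  ...   | yes _ = refl
  ...   | no  _ = refl

  rev-at-within : ∀ C {c} → c ≤ bound C → rev-at C c ≡ ℕ→ℚ (weight C) * f c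
  rev-at-within C {c} c≤u with c ≤? bound C
  ... | yes _   = refl
  ... | no  c≰u = contradiction c≤u c≰u

  rev-at-nonNeg : ∀ C c → 0ℚ ≤ℚ rev-at C c
  rev-at-nonNeg C c with c ≤? bound C
  ... | yes _ = ℚ.nonNegative⁻¹ _
          {{ℚ.nonNeg*nonNeg⇒nonNeg (ℕ→ℚ (weight C)) {{ℚ.normalize-nonNeg (weight C) 1}}
                                    (f c) {{ℚ.nonNegative (f-nonneg c)}}}}
  ... | no  _ = ℚ.≤-refl

  -- a ≤ c and b ≤ c keep a and b within the bound whenever c is.
  rev-at-subadditive : ∀ C {a b c} → c ≤ a ℕ.+ b → a ≤ c → b ≤ c →
    rev-at C c ≤ℚ rev-at C a + rev-at C b
  rev-at-subadditive C {a} {b} {c} c≤a+b a≤c b≤c with c ≤? bound C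
  ... | yes c≤u
    rewrite rev-at-within C (ℕ.≤-trans a≤c c≤u) | rev-at-within C (ℕ.≤-trans b≤c c≤u)
          = subst (w * f c ≤ℚ_) (ℚ.*-distribˡ-+ w (f a) (f b))
              (ℚ.*-monoˡ-≤-nonNeg w {{ℚ.normalize-nonNeg (weight C) 1}}
                (Concave⇒subadditive f-conc f-mono f-nonneg c≤a+b))
    where w = ℕ→ℚ (weight C)
  ... | no _ = ℚ.+-mono-≤ (rev-at-nonNeg C a) (rev-at-nonNeg C b)

  rev-i-∪ : ∀ (A B : Subset ne) i → rev-i I i (A ∪ B) ≤ℚ rev-i I i A + rev-i I i B
  rev-i-∪ A B i
    rewrite rev-i≡rev-at i (A ∪ B) | rev-i≡rev-at i A | rev-i≡rev-at i B =
    rev-at-subadditive (com i) (countIn-∪ A B P)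
      (countIn-mono (p⊆p∪q B) P) (countIn-mono (q⊆p∪q A B) P)
    where P = path (com i)

  rev-∪ : ∀ (A B : Subset ne) → rev I (A ∪ B) ≤ℚ rev I A + rev I B
  rev-∪ A B = sumℚ-map-subadditive (rev-i-∪ A B) (allFin k)

lemma6 : (I : FZA) → (F : Subset (Graph.ne (FZA.G I))) → 1 ≤ ∣ F ∣ →
    ∃ λ (F′ : Subset (Graph.ne (FZA.G I))) →
      F′ ⊆ F × ∣ F′ ∣ ≡ 2 ^ ⌊log₂ ∣ F ∣ ⌋ × ½ * rev I F ≤ℚ rev I F′
lemma6 I F 1≤∣F∣ =
  [ (λ ½revF≤revA → A , (λ {_} → take-⊆ p F) , ∣take∣≡ p F p≤∣F∣ , ½revF≤revA)
  , (λ ½revF≤revB → B , (λ {_} → drop-⊆ q F) , trans (∣drop∣≡ q F) (ℕ.m∸[m∸n]≡n p≤∣F∣) , ½revF≤revB)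
  ]′ (half-≤-max revF≤revA+revB)
  where
  p = 2 ^ ⌊log₂ ∣ F ∣ ⌋
  q = ∣ F ∣ ∸ p
  A = take p F
  B = drop q F
  p≤∣F∣ : p ≤ ∣ F ∣
  p≤∣F∣ = 2^⌊log₂n⌋≤n ∣ F ∣ {{ℕ.>-nonZero 1≤∣F∣}}
  revF≤revA+revB : rev I F ≤ℚ rev I A + rev I B
  revF≤revA+revB = subst (λ X → rev I X ≤ℚ rev I A + rev I B)
    (take∪drop≡ (n∸2^⌊log₂n⌋≤2^⌊log₂n⌋ ∣ F ∣) F) (rev-∪ I A B)
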